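{- Let $k,t,m\in\mathbb{N}$. Then there exists $N_0=N(k,t,m)\in\mathbb{N}$ such that for every $m$-type colouring $\Delta:[N_0]\to\mathbb{N}^m$ at least one of the following holds: (1) there is an arithmetic progression $A\subseteq[N_0]$ of length $k$ which is monochromatic; (2) there is an arithmetic progression $B\subseteq[N_0]$ of length $t$ which is rainbow.
   Context: $[N]=\{1,\ldots,N\}$. An $m$-type colouring of $[N]$ is a map $\Delta:[N]\to\mathbb{N}^m$; for $a\in[N]$ and $j\in\{1,\ldots,m\}$, $\Delta_j(a)$ denotes the $j$-th coordinate of $\Delta(a)$. An arithmetic progression of length $\ell$ is a set $\{a,a+d,\ldots,a+(\ell-1)d\}$ with $a\in\mathbb{Z}$ and $d$ a positive integer. A set $\{a_1,\ldots,a_\ell\}$ is monochromatic if there is a coordinate $j\in\{1,\ldots,m\}$ with $\Delta_j(a_i)=\Delta_j(a_{i'})$ for all $i,i'$. It is rainbow if $\Delta_j(a_i)\neq\Delta_{j'}(a_{i'})$ for all $i\neq i'$ in $\{1,\ldots,\ell\}$ and all $j,j'\in\{1,\ldots,m\}$. -}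

module Defs where

open import Data.Nat using (ℕ; _+_; _*_; _≤_; _<_; suc)
open import Data.Fin using (Fin)
open import Data.Product using (Σ; _×_; ∃)
open import Relation.Binary.PropositionalEquality using (_≡_; _≢_)

-- An m-type colouring of [N] = {1,…,N}: Δ : [N] → ℕ^m, given as
-- Δ a j = Δ_j(a).  Values outside [N] are irrelevant.
Colouring : ℕ → Set
Colouring m = ℕ → Fin m → ℕ

apElem : ℕ → ℕ → ℕ → ℕ
apElem a d i = a + i * d

APin : ℕ → ℕ → ℕ → ℕ → Set
APin N ℓ a d = (1 ≤ d) × (∀ i → i < ℓ → (1 ≤ apElem a d i) × (apElem a d i ≤ N))

Monochromatic : ∀ {m} → Colouring m → ℕ → ℕ → ℕ → Set
Monochromatic {m} Δ ℓ a d =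
  Σ (Fin m) λ j → ∀ i i' → i < ℓ → i' < ℓ →
    Δ (apElem a d i) j ≡ Δ (apElem a d i') j

Rainbow : ∀ {m} → Colouring m → ℕ → ℕ → ℕ → Set
Rainbow {m} Δ ℓ a d =
  ∀ i i' → i < ℓ → i' < ℓ → i ≢ i' → (j j' : Fin m) →
    Δ (apElem a d i) j ≢ Δ (apElem a d i') j'

HasMonoAP : ∀ {m} → ℕ → Colouring m → ℕ → Set
HasMonoAP N Δ ℓ = Σ ℕ λ a → Σ ℕ λ d → APin N ℓ a d × Monochromatic Δ ℓ a d

HasRainbowAP : ∀ {m} → ℕ → Colouring m → ℕ → Set
HasRainbowAP N Δ ℓ = Σ ℕ λ a → Σ ℕ λ d → APin N ℓ a d × Rainbow Δ ℓ a d

-- Colour a pair (a, d) by the equality pattern of the progression a, a + d, …, a + (t-1)d, i.e. by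
-- which of the values Δ_j(a + i d) coincide; there are finitely many patterns.  Gallai's theorem in
-- the plane, proved by colour focusing, yields s ≥ 1 and a pair (a, d) such that all pairs
-- (a + s(U - lo r), d + s r) with lo < t, r ≤ k carry the pattern of (a, d).  If the progression
-- (a, d) is not rainbow, two of its terms lo < hi share a value Δ_jl = Δ_jh, hence so do the same
-- terms of every progression of the copy.  For fixed lo, term lo of these progressions is the number
-- a + sU + lo d for every r, while term hi runs through a + sU + hi d + r (hi - lo) s, r < k, which is
-- therefore a progression monochromatic in coordinate jh.

module Submission where

open import Defs
open import Data.Nat
  using (ℕ; zero; suc; _+_; _*_; _∸_; _^_; _≤_; _<_; z≤n; s≤s; z<s; NonZero; >-nonZero; _≟_)
open import Data.Nat.Properties hiding (_≟_)
open import Data.Nat.DivMod using (_%_; _/_; [m+kn]%n≡m%n; m<n⇒m%n≡m; m%n<n; m≡m%n+[m/n]*n)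
open import Data.Nat.Tactic.RingSolver using (solve-∀)
open import Data.Fin using (Fin; zero; suc; toℕ; fromℕ<)
open import Data.Fin.Properties using (toℕ-fromℕ<; any?; pigeonhole) renaming (<-irrefl to <-irreflᶠ)
open import Data.Product using (Σ; ∃; _×_; _,_; proj₁; proj₂)
open import Data.Sum using (_⊎_; inj₁; inj₂; [_,_]′)
open import Data.Empty using (⊥-elim)
open import Function using (_∘_; id)
open import Function.Definitions using (Injective)
open import Relation.Nullary using (Dec; yes; no; ¬_)
open import Relation.Binary.Definitions using (tri<; tri≈; tri>)
open import Relation.Binary.PropositionalEquality

encode : ℕ → ∀ {n} → (Fin n → ℕ) → ℕ
encode c {zero}  g = 0
encode c {suc n} g = g zero + encode c (g ∘ suc) * c

encode-< : ∀ c {n} (g : Fin n → ℕ) → (∀ i → g i < c) → encode c g < c ^ n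
encode-< c {zero}  g g<c = s≤s z≤n
encode-< c {suc n} g g<c = begin-strict
  g zero + encode c (g ∘ suc) * c  <⟨ +-monoˡ-< _ (g<c zero) ⟩
  suc (encode c (g ∘ suc)) * c     ≤⟨ *-monoˡ-≤ c (encode-< c (g ∘ suc) (g<c ∘ suc)) ⟩
  c ^ n * c                        ≡⟨ *-comm (c ^ n) c ⟩
  c ^ suc n                        ∎
  where open ≤-Reasoning

digits-unique : ∀ {c a b x y} → a < c → b < c → a + x * c ≡ b + y * c → a ≡ b × x ≡ y
digits-unique {c} {a} {b} {x} {y} a<c b<c eq =
  a≡b , *-cancelʳ-≡ x y c (+-cancelˡ-≡ b _ _ (subst (λ u → u + x * c ≡ b + y * c) a≡b eq))
  where
  instance
    c≢0 : NonZero c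
    c≢0 = >-nonZero (≤-<-trans z≤n a<c)
  open ≡-Reasoning
  a≡b : a ≡ b
  a≡b = begin
    a                ≡⟨ sym (m<n⇒m%n≡m a<c) ⟩
    a % c            ≡⟨ sym ([m+kn]%n≡m%n a x c) ⟩
    (a + x * c) % c  ≡⟨ cong (_% c) eq ⟩
    (b + y * c) % c  ≡⟨ [m+kn]%n≡m%n b y c ⟩
    b % c            ≡⟨ m<n⇒m%n≡m b<c ⟩
    b                ∎

encode-injective : ∀ c {n} {g h : Fin n → ℕ} → (∀ i → g i < c) → (∀ i → h i < c) →
                   encode c g ≡ encode c h → ∀ i → g i ≡ h i
encode-injective c {suc n} {g} {h} g<c h<c eq i
  with digits-unique {x = encode c (g ∘ suc)} {encode c (h ∘ suc)} (g<c zero) (h<c zero) eq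
encode-injective c g<c h<c eq zero    | head≡ , _     = head≡
encode-injective c g<c h<c eq (suc i) | _     , tail≡ = encode-injective c (g<c ∘ suc) (h<c ∘ suc) tail≡ i

encode₂ : ℕ → ∀ {p q} → (Fin p → Fin q → ℕ) → ℕ
encode₂ c {q = q} g = encode (c ^ q) (encode c ∘ g)

encode₂-< : ∀ c {p q} (g : Fin p → Fin q → ℕ) → (∀ i j → g i j < c) → encode₂ c g < (c ^ q) ^ p
encode₂-< c g g<c = encode-< _ (encode c ∘ g) (λ i → encode-< c (g i) (g<c i))

encode₂-injective : ∀ c {p q} {g h : Fin p → Fin q → ℕ} → (∀ i j → g i j < c) → (∀ i j → h i j < c) →
                    encode₂ c g ≡ encode₂ c h → ∀ i j → g i j ≡ h i j
encode₂-injective c g<c h<c eq i =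
  encode-injective c (g<c i) (h<c i)
    (encode-injective _ (λ i → encode-< c _ (g<c i)) (λ i → encode-< c _ (h<c i)) eq i)

block-< : ∀ {N M X p} → X < M → p < N → N * X + p < N * M
block-< {N} {M} {X} {p} X<M p<N = begin-strict
  N * X + p  <⟨ +-monoʳ-< (N * X) p<N ⟩
  N * X + N  ≡⟨ +-comm (N * X) N ⟩
  N + N * X  ≡⟨ *-suc N X ⟨
  N * suc X  ≤⟨ *-monoʳ-≤ N X<M ⟩
  N * M      ∎
  where open ≤-Reasoning

translate-< : ∀ {M X Λ s S} → X < M → Λ ≤ M → s ≤ S → X + Λ * s < suc M + M * S
translate-< X<M Λ≤M s≤S = s≤s (+-mono-≤ (<⇒≤ X<M) (*-mono-≤ Λ≤M s≤S))

rescale-≤ : ∀ {N M l Λ} k → l ≤ N → Λ ≤ M → l + N * Λ ≤ N * (suc M + k)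
rescale-≤ {N} {M} {l} {Λ} k l≤N Λ≤M = begin
  l + N * Λ        ≤⟨ +-mono-≤ l≤N (*-monoʳ-≤ N Λ≤M) ⟩
  N + N * M        ≡⟨ *-suc N M ⟨
  N * suc M        ≤⟨ *-monoʳ-≤ N (m≤m+n (suc M) k) ⟩
  N * (suc M + k)  ∎
  where open ≤-Reasoning

rescale : ∀ N X x l Λ e → N * X + x + (l + N * Λ) * e ≡ N * (X + Λ * e) + (x + l * e)
rescale = solve-∀

rescale₀ : ∀ N X x Λ e → N * X + x + N * Λ * e ≡ N * (X + Λ * e) + x
rescale₀ N X x Λ e = trans (rescale N X x 0 Λ e) (cong (N * (X + Λ * e) +_) (+-identityʳ x))

PlaneColouring : Set
PlaneColouring = ℕ → ℕ → ℕ

Bounded : ℕ → PlaneColouring → Set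
Bounded c f = ∀ x y → f x y < c

block : ℕ → PlaneColouring → ℕ → ℕ → PlaneColouring
block N f X Y p q = f (N * X + p) (N * Y + q)

blockColouring : ℕ → ℕ → PlaneColouring → PlaneColouring
blockColouring c N f X Y = encode₂ c {N} {N} (λ p q → block N f X Y (toℕ p) (toℕ q))

blockColouring-bounded : ∀ {c} N {f} → Bounded c f → Bounded ((c ^ N) ^ N) (blockColouring c N f)
blockColouring-bounded N f<c X Y = encode₂-< _ {N} {N} _ (λ p q → f<c (N * X + toℕ p) (N * Y + toℕ q))

blockColouring-injective : ∀ {c N f} → Bounded c f → ∀ {X Y X' Y'} →
  blockColouring c N f X Y ≡ blockColouring c N f X' Y' →
  ∀ {p q} → p < N → q < N → block N f X Y p q ≡ block N f X' Y' p q
blockColouring-injective {N = N} {f} f<c {X} {Y} {X'} {Y'} eq p<N q<N =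
  subst₂ (λ p q → block N f X Y p q ≡ block N f X' Y' p q) (toℕ-fromℕ< p<N) (toℕ-fromℕ< q<N)
    (encode₂-injective _ (λ _ _ → f<c _ _) (λ _ _ → f<c _ _) eq (fromℕ< p<N) (fromℕ< q<N))

module Gallai (e₁ e₂ : ℕ → ℕ) where

  ColouredPoint : PlaneColouring → (W u v colour : ℕ) → Set
  ColouredPoint f W u v colour = (u < W) × (v < W) × (f u v ≡ colour)

  CopyColoured : PlaneColouring → (n W x y l colour : ℕ) → Set
  CopyColoured f n W x y l colour = ∀ i → i < n → ColouredPoint f W (x + l * e₁ i) (y + l * e₂ i) colour

  extend : ∀ {f n W x y l colour} → CopyColoured f n W x y l colour →
    ColouredPoint f W (x + l * e₁ n) (y + l * e₂ n) colour → CopyColoured f (suc n) W x y l colour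
  extend C Cₙ i i<1+n with m<1+n⇒m<n∨m≡n i<1+n
  ... | inj₁ i<n  = C i i<n
  ... | inj₂ refl = Cₙ

  -- The copy includes its base point (x, y): it is a homothet of {0, e 0, …, e (n-1)}.
  MonoCopy : ℕ → PlaneColouring → ℕ → Set
  MonoCopy n f W = Σ ℕ λ x → Σ ℕ λ y → Σ ℕ λ l →
    (1 ≤ l) × (l ≤ W) × (x < W) × (y < W) × CopyColoured f n W x y l (f x y)

  GallaiBound : ℕ → Set
  GallaiBound n = ∀ c → Σ ℕ λ W → ∀ f → Bounded c f → MonoCopy n f W

  record FocusedCopy (c n N z₁ z₂ : ℕ) (f : PlaneColouring) : Set where
    field
      x y l colour : ℕ
      1≤l         : 1 ≤ l
      l≤N         : l ≤ N
      x<N         : x < N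
      y<N         : y < N
      colour<c    : colour < c
      base-colour : f x y ≡ colour
      coloured    : CopyColoured f n N x y l colour
      focus₁      : x + l * e₁ n ≡ z₁
      focus₂      : y + l * e₂ n ≡ z₂

  Focused : ℕ → ℕ → PlaneColouring → ℕ → ℕ → Set
  Focused c n f N r = Σ ℕ λ z₁ → Σ ℕ λ z₂ → (z₁ < N) × (z₂ < N) ×
    Σ (Fin r → FocusedCopy c n N z₁ z₂ f) λ F → Injective _≡_ _≡_ (FocusedCopy.colour ∘ F)

  ¬Focused-suc : ∀ {c n f N} → ¬ Focused c n f N (suc c)
  ¬Focused-suc {c} (_ , _ , _ , _ , F , F-inj)
    with s , s' , s<s' , eq ← pigeonhole (n<1+n c) (λ s → fromℕ< (FocusedCopy.colour<c (F s)))
    = <-irreflᶠ (F-inj (trans (sym (toℕ-fromℕ< _)) (trans (cong toℕ eq) (toℕ-fromℕ< _)))) s<s'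

  completeCopy : ∀ {c n N z₁ z₂ f} → z₁ < N → z₂ < N → (C : FocusedCopy c n N z₁ z₂ f) →
    f z₁ z₂ ≡ FocusedCopy.colour C → MonoCopy (suc n) f N
  completeCopy {n = n} {N} {f = f} z₁<N z₂<N C fz≡ =
    x , y , l , 1≤l , l≤N , x<N , y<N ,
    subst (CopyColoured f (suc n) N x y l) (sym base-colour)
      (extend {f = f} {n} {N} {x} {y} {l} coloured focus)
    where
    open FocusedCopy C
    focus : ColouredPoint f N (x + l * e₁ n) (y + l * e₂ n) colour
    focus rewrite focus₁ | focus₂ = z₁<N , z₂<N , fz≡

  module FocusingStep {n c r N M : ℕ} (1≤N : 1 ≤ N)
      (focusing : ∀ g → Bounded c g → MonoCopy (suc n) g N ⊎ Focused c n g N r)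
      {f : PlaneColouring} (f<c : Bounded c f)
      {X Y Λ : ℕ} (1≤Λ : 1 ≤ Λ) (Λ≤M : Λ ≤ M) (X<M : X < M) (Y<M : Y < M)
      (blocks : CopyColoured (blockColouring c N f) n M X Y Λ (blockColouring c N f X Y)) where

    -- Leaves room for the block X + Λ e n that will contain the new focus.
    M' : ℕ
    M' = suc M + M * (e₁ n + e₂ n)

    N' : ℕ
    N' = N * M'

    g : PlaneColouring
    g = block N f X Y

    M≤M' : M ≤ M'
    M≤M' = m≤n⇒m≤n+o _ (n≤1+n M)

    X<M' : X < M'
    X<M' = <-≤-trans X<M M≤M'

    Y<M' : Y < M'
    Y<M' = <-≤-trans Y<M M≤M'

    translate : ∀ {m x y l colour} → CopyColoured g m N x y l colour →
                CopyColoured f m N' (N * X + x) (N * Y + y) l colour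
    translate {x = x} {y} {l} C i i<m
      rewrite +-assoc (N * X) x (l * e₁ i) | +-assoc (N * Y) y (l * e₂ i)
      with u<N , v<N , gu≡ ← C i i<m
      = block-< X<M' u<N , block-< Y<M' v<N , gu≡

    liftMono : ∀ {m} → MonoCopy m g N → MonoCopy m f N'
    liftMono (x , y , l , 1≤l , l≤N , x<N , y<N , C) =
      N * X + x , N * Y + y , l , 1≤l , ≤-trans l≤N (m≤m*n N M') ,
      block-< X<M' x<N , block-< Y<M' y<N , translate {l = l} C

    sameBlock : ∀ {i a b colour} → i < n → ColouredPoint g N a b colour →
      ColouredPoint f N' (N * (X + Λ * e₁ i) + a) (N * (Y + Λ * e₂ i) + b) colour
    sameBlock {i} i<n (a<N , b<N , ga≡) with X'<M , Y'<M , same ← blocks i i<n =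
      block-< (<-≤-trans X'<M M≤M') a<N , block-< (<-≤-trans Y'<M M≤M') b<N ,
      trans (blockColouring-injective f<c same a<N b<N) ga≡

    relocate : ∀ {u v u' v' colour} → u ≡ u' → v ≡ v' →
               ColouredPoint f N' u' v' colour → ColouredPoint f N' u v colour
    relocate refl refl P = P

    refocused : ∀ {z₁ z₂} → z₁ < N → z₂ < N → (F : Fin r → FocusedCopy c n N z₁ z₂ g) →
      Injective _≡_ _≡_ (FocusedCopy.colour ∘ F) → (∀ s → g z₁ z₂ ≢ FocusedCopy.colour (F s)) →
      Focused c n f N' (suc r)
    refocused {z₁} {z₂} z₁<N z₂<N F F-inj fresh =
      Z₁ , Z₂ ,
      block-< (translate-< X<M Λ≤M (m≤m+n _ _)) z₁<N , block-< (translate-< Y<M Λ≤M (m≤n+m _ _)) z₂<N ,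
      F' , F'-inj
      where
      Z₁ = N * (X + Λ * e₁ n) + z₁
      Z₂ = N * (Y + Λ * e₂ n) + z₂

      new : FocusedCopy c n N' Z₁ Z₂ f
      new = record
        { x = N * X + z₁ ; y = N * Y + z₂ ; l = N * Λ ; colour = g z₁ z₂
        ; 1≤l = *-mono-≤ 1≤N 1≤Λ ; l≤N = *-monoʳ-≤ N (≤-trans Λ≤M M≤M')
        ; x<N = block-< X<M' z₁<N ; y<N = block-< Y<M' z₂<N
        ; colour<c = f<c _ _ ; base-colour = refl
        ; coloured = λ i i<n → relocate (rescale₀ N X z₁ Λ (e₁ i)) (rescale₀ N Y z₂ Λ (e₂ i))
                                        (sameBlock i<n (z₁<N , z₂<N , refl))
        ; focus₁ = rescale₀ N X z₁ Λ (e₁ n) ; focus₂ = rescale₀ N Y z₂ Λ (e₂ n)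
        }

      lifted : FocusedCopy c n N z₁ z₂ g → FocusedCopy c n N' Z₁ Z₂ f
      lifted C = record
        { x = N * X + x ; y = N * Y + y ; l = l + N * Λ ; colour = colour
        ; 1≤l = ≤-trans 1≤l (m≤m+n l _) ; l≤N = rescale-≤ _ l≤N Λ≤M
        ; x<N = block-< X<M' x<N ; y<N = block-< Y<M' y<N
        ; colour<c = colour<c ; base-colour = base-colour
        ; coloured = λ i i<n → relocate (rescale N X x l Λ (e₁ i)) (rescale N Y y l Λ (e₂ i))
                                        (sameBlock i<n (coloured i i<n))
        ; focus₁ = trans (rescale N X x l Λ (e₁ n)) (cong (N * (X + Λ * e₁ n) +_) focus₁)
        ; focus₂ = trans (rescale N Y y l Λ (e₂ n)) (cong (N * (Y + Λ * e₂ n) +_) focus₂)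
        }
        where open FocusedCopy C

      F' : Fin (suc r) → FocusedCopy c n N' Z₁ Z₂ f
      F' zero    = new
      F' (suc s) = lifted (F s)

      F'-inj : Injective _≡_ _≡_ (FocusedCopy.colour ∘ F')
      F'-inj {zero}  {zero}   _  = refl
      F'-inj {zero}  {suc s}  eq = ⊥-elim (fresh s eq)
      F'-inj {suc s} {zero}   eq = ⊥-elim (fresh s (sym eq))
      F'-inj {suc s} {suc s'} eq = cong suc (F-inj eq)

    step : MonoCopy (suc n) f N' ⊎ Focused c n f N' (suc r)
    step with focusing g (λ _ _ → f<c _ _)
    ... | inj₁ mono = inj₁ (liftMono mono)
    ... | inj₂ (z₁ , z₂ , z₁<N , z₂<N , F , F-inj) with any? (λ s → g z₁ z₂ ≟ FocusedCopy.colour (F s))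
    ...   | yes (s , gz≡) = inj₁ (liftMono (completeCopy z₁<N z₂<N (F s) gz≡))
    ...   | no  gz≢       = inj₂ (refocused z₁<N z₂<N F F-inj (λ s gz≡ → gz≢ (s , gz≡)))

  -- Colour focusing: a monochromatic copy of n blocks for the colouring by block contents carries
  -- every focused family found inside one block to a common new focus, with one more colour.
  focusing : ∀ n → GallaiBound n → ∀ c r → Σ ℕ λ N → (1 ≤ N) ×
    (∀ f → Bounded c f → MonoCopy (suc n) f N ⊎ Focused c n f N r)
  focusing n gallaiₙ c zero = 1 , s≤s z≤n , λ _ _ → inj₂ (0 , 0 , z<s , z<s , (λ ()) , λ { {()} })
  focusing n gallaiₙ c (suc r)
    with N , 1≤N , focusingᵣ ← focusing n gallaiₙ c r
    with M , blocksMono ← gallaiₙ ((c ^ N) ^ N) =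
    N * (suc M + M * (e₁ n + e₂ n)) , *-mono-≤ 1≤N (s≤s z≤n) , λ f f<c →
      let (X , Y , Λ , 1≤Λ , Λ≤M , X<M , Y<M , blocks) =
            blocksMono (blockColouring c N f) (blockColouring-bounded N f<c)
      in FocusingStep.step 1≤N focusingᵣ f<c 1≤Λ Λ≤M X<M Y<M blocks

  gallai : ∀ n → GallaiBound n
  gallai zero c = 1 , λ _ _ → 0 , 0 , 1 , s≤s z≤n , s≤s z≤n , z<s , z<s , λ _ ()
  gallai (suc n) c with N , _ , focusingₙ ← focusing n (gallai n) c (suc c) =
    N , λ f f<c → [ id , ⊥-elim ∘ ¬Focused-suc ]′ (focusingₙ f f<c)

agreement : ℕ → ℕ → ℕ
agreement u v with u ≟ v
... | yes _ = 1
... | no  _ = 0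

agreement-< : ∀ u v → agreement u v < 2
agreement-< u v with u ≟ v
... | yes _ = s≤s (s≤s z≤n)
... | no  _ = s≤s z≤n

agreement-transfer : ∀ {u v u' v'} → agreement u v ≡ agreement u' v' → u ≡ v → u' ≡ v'
agreement-transfer {u} {v} {u'} {v'} eq u≡v with u ≟ v | u' ≟ v'
agreement-transfer _  _   | _       | yes u'≡v' = u'≡v'
agreement-transfer () _   | yes _   | no  _
agreement-transfer _  u≡v | no  u≢v | no  _     = ⊥-elim (u≢v u≡v)

patternCount : ℕ → ℕ → ℕ
patternCount t m = (((2 ^ m) ^ t) ^ m) ^ t

agreementTable : ∀ {m} → Colouring m → (t a d : ℕ) → Fin t → Fin m → Fin t → Fin m → ℕ
agreementTable Δ t a d i j i' j' = agreement (Δ (apElem a d (toℕ i)) j) (Δ (apElem a d (toℕ i')) j')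

agreementTable-< : ∀ {m} (Δ : Colouring m) t a d i j i' j' → agreementTable Δ t a d i j i' j' < 2
agreementTable-< Δ t a d i j i' j' = agreement-< _ _

agreementRow-< : ∀ {m} (Δ : Colouring m) t a d i j → encode₂ 2 (agreementTable Δ t a d i j) < (2 ^ m) ^ t
agreementRow-< Δ t a d i j = encode₂-< 2 _ (agreementTable-< Δ t a d i j)

equalityPattern : ∀ {m} → Colouring m → (t a d : ℕ) → ℕ
equalityPattern {m} Δ t a d = encode₂ ((2 ^ m) ^ t) (λ i j → encode₂ 2 (agreementTable Δ t a d i j))

equalityPattern-< : ∀ {m} (Δ : Colouring m) t a d → equalityPattern Δ t a d < patternCount t m
equalityPattern-< Δ t a d = encode₂-< _ _ (agreementRow-< Δ t a d)

equalityPattern-transfer : ∀ {m} (Δ : Colouring m) {t a d a' d'} →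
  equalityPattern Δ t a d ≡ equalityPattern Δ t a' d' →
  ∀ {i i' j j'} → i < t → i' < t →
  Δ (apElem a d i) j ≡ Δ (apElem a d i') j' → Δ (apElem a' d' i) j ≡ Δ (apElem a' d' i') j'
equalityPattern-transfer Δ {t} {a} {d} {a'} {d'} eq {i} {i'} {j} {j'} i<t i'<t
  with agreement-transfer
         (encode₂-injective 2 (agreementTable-< Δ t a d (fromℕ< i<t) j)
                              (agreementTable-< Δ t a' d' (fromℕ< i<t) j)
           (encode₂-injective _ (agreementRow-< Δ t a d) (agreementRow-< Δ t a' d') eq (fromℕ< i<t) j)
           (fromℕ< i'<t) j')
... | transfer rewrite toℕ-fromℕ< i<t | toℕ-fromℕ< i'<t = transfer

Collision : ∀ {m} → Colouring m → (t a d : ℕ) → Set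
Collision Δ t a d = ∃ λ hi → hi < t × ∃ λ lo → lo < hi × ∃ λ jl → ∃ λ jh →
  Δ (apElem a d lo) jl ≡ Δ (apElem a d hi) jh

collision? : ∀ {m} (Δ : Colouring m) t a d → Dec (Collision Δ t a d)
collision? Δ t a d = anyUpTo? (λ hi → anyUpTo? (λ lo → any? λ jl → any? λ jh →
  Δ (apElem a d lo) jl ≟ Δ (apElem a d hi) jh) hi) t

rainbow-or-collision : ∀ {m} (Δ : Colouring m) t a d → Rainbow Δ t a d ⊎ Collision Δ t a d
rainbow-or-collision Δ t a d with collision? Δ t a d
... | yes collision = inj₂ collision
... | no ¬collision = inj₁ rainbow
  where
  rainbow : Rainbow Δ t a d
  rainbow i i' i<t i'<t i≢i' j j' eq with <-cmp i i'
  ... | tri< i<i' _ _ = ¬collision (i' , i'<t , i , i<i' , j , j' , eq)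
  ... | tri≈ _ i≡i' _ = i≢i' i≡i'
  ... | tri> _ _ i'<i = ¬collision (i , i<t , i' , i'<i , j' , j , sym eq)

sweep-fixed : ∀ a d s V lo r → a + s * V + lo * (d + s * r) ≡ a + s * (V + lo * r) + lo * d
sweep-fixed = solve-∀

sweep-moving : ∀ a d s V lo δ r →
  a + s * V + (lo + δ) * (d + s * r) ≡ a + s * (V + lo * r) + (lo + δ) * d + r * (δ * s)
sweep-moving = solve-∀

sweep-terms : ∀ a d s U V lo hi δ r → V + lo * r ≡ U → lo + δ ≡ hi →
  (apElem (a + s * V) (d + s * r) lo ≡ apElem (a + s * U) d lo) ×
  (apElem (a + s * V) (d + s * r) hi ≡ apElem (apElem (a + s * U) d hi) (δ * s) r)
sweep-terms a d s _ V lo _ δ r refl refl = sweep-fixed a d s V lo r , sweep-moving a d s V lo δ r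

module MonochromaticOrRainbow (k t m : ℕ) where

  -- Rows have length suc k so that the divisor is nonzero; only columns r < k are used.
  K : ℕ
  K = suc k

  U : ℕ
  U = t * K

  row column : ℕ → ℕ
  row l = l / K
  column l = l % K

  open Gallai (λ l → U ∸ row l * column l) column

  grid-coordinates : ∀ {lo r} → r < K → column (r + lo * K) ≡ r × row (r + lo * K) ≡ lo
  grid-coordinates {lo} {r} r<K =
    digits-unique (m%n<n (r + lo * K) K) r<K (sym (m≡m%n+[m/n]*n (r + lo * K) K))

  grid-< : ∀ {lo r} → lo < t → r < K → r + lo * K < t * K
  grid-< {lo} {r} lo<t r<K = <-≤-trans (+-monoˡ-< (lo * K) r<K) (*-monoˡ-≤ K lo<t)

  W : ℕ
  W = proj₁ (gallai (t * K) (patternCount t m))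

  N₀ : ℕ
  N₀ = suc t * W

  apElem-≤ : ∀ {x y i} → x < W → y < W → i < t → apElem (suc x) (suc y) i ≤ N₀
  apElem-≤ x<W y<W i<t = +-mono-≤ x<W (*-mono-≤ (<⇒≤ i<t) y<W)

  module _ (Δ : Colouring m) where

    patternColouring : PlaneColouring
    patternColouring x y = equalityPattern Δ t (suc x) (suc y)

    gridPoint : ∀ {x y s} → CopyColoured patternColouring (t * K) W x y s (patternColouring x y) →
      ∀ {lo r} → lo < t → r < K →
      ColouredPoint patternColouring W (x + s * (U ∸ lo * r)) (y + s * r) (patternColouring x y)
    gridPoint {x} {y} {s} copy {lo} {r} lo<t r<K with column≡ , row≡ ← grid-coordinates {lo} r<K =
      subst₂ (λ u v → ColouredPoint patternColouring W (x + s * (U ∸ u * v)) (y + s * v)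
                                    (patternColouring x y))
        row≡ column≡ (copy (r + lo * K) (grid-< lo<t r<K))

    sweep : ∀ {x y s} → 1 ≤ s → CopyColoured patternColouring (t * K) W x y s (patternColouring x y) →
      Collision Δ t (suc x) (suc y) → HasMonoAP N₀ Δ k
    sweep {x} {y} {s} 1≤s copy (hi , hi<t , lo , lo<hi , jl , jh , same) =
      start , D , (*-mono-≤ (m<n⇒0<n∸m lo<hi) 1≤s , λ r r<k → s≤s z≤n , proj₁ (term r r<k)) ,
      jh , λ r r' r<k r'<k → trans (proj₂ (term r r<k)) (sym (proj₂ (term r' r'<k)))
      where
      start = apElem (suc x + s * U) (suc y) hi
      pivot = apElem (suc x + s * U) (suc y) lo
      D = (hi ∸ lo) * s
      lo<t = <-trans lo<hi hi<t

      term : ∀ r → r < k → (apElem start D r ≤ N₀) × (Δ (apElem start D r) jh ≡ Δ pivot jl)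
      term r r<k
        with V<W , y'<W , pattern≡ ← gridPoint {s = s} copy lo<t (m<n⇒m<1+n r<k)
        with fixed , moving ← sweep-terms (suc x) (suc y) s U (U ∸ lo * r) lo hi (hi ∸ lo) r
               (m∸n+n≡m (*-mono-≤ (<⇒≤ lo<t) (<⇒≤ (m<n⇒m<1+n r<k)))) (m+[n∸m]≡n (<⇒≤ lo<hi))
        = subst (_≤ N₀) moving (apElem-≤ V<W y'<W hi<t) ,
          subst₂ (λ u v → Δ v jh ≡ Δ u jl) fixed moving
            (sym (equalityPattern-transfer Δ (sym pattern≡) lo<t hi<t same))

    monochromatic-or-rainbow : HasMonoAP N₀ Δ k ⊎ HasRainbowAP N₀ Δ t
    monochromatic-or-rainbow
      with x , y , s , 1≤s , _ , x<W , y<W , copy ←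
             proj₂ (gallai (t * K) (patternCount t m)) patternColouring (λ _ _ → equalityPattern-< Δ t _ _)
      with rainbow-or-collision Δ t (suc x) (suc y)
    ... | inj₁ rainbow   =
      inj₂ (suc x , suc y , (s≤s z≤n , λ i i<t → s≤s z≤n , apElem-≤ x<W y<W i<t) , rainbow)
    ... | inj₂ collision = inj₁ (sweep 1≤s copy collision)

theorem4 : (k t m : ℕ) → Σ ℕ λ N₀ → (Δ : Colouring m) →
    HasMonoAP N₀ Δ k ⊎ HasRainbowAP N₀ Δ t
theorem4 k t m = N₀ , monochromatic-or-rainbow
  where open MonochromaticOrRainbow k t m
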